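{- Let $n$ be even and let $f:\mathbb{F}_{2^n}\to\mathbb{F}_{2^n}$ be an APN map such that $f(0)=0$ and every $y\in\mathrm{Im}(f)\setminus\{0\}$ has at least 3 preimages under $f$. Then $f$ is almost-3-to-1.
   Context: A map $f:\mathbb{F}_{2^n}\to\mathbb{F}_{2^n}$ is APN if for every $a\neq 0$ and every $b$ the equation $f(x+a)+f(x)=b$ has at most 2 solutions. A map is almost-3-to-1 if there is a unique element of $\mathrm{Im}(f)$ with exactly one preimage and every other element of $\mathrm{Im}(f)$ has exactly 3 preimages. -}

module Defs where

open import Data.Nat using (ℕ; zero; suc; _≤_)
open import Data.Bool using (Bool; true; false; _xor_)
open import Data.Bool.Properties using () renaming (_≟_ to _≟B_)
open import Data.Vec using (Vec; []; _∷_; zipWith; replicate)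
open import Data.Vec.Properties using (≡-dec)
open import Data.List using (List; []; _∷_; _++_; map; filter; length)
open import Data.Product using (Σ; ∃; _×_; _,_)
open import Relation.Binary.PropositionalEquality using (_≡_)
open import Relation.Nullary using (¬_)

-- The additive group of F_{2^n}: coordinate vectors over F_2 with respect to
-- an F_2-basis; field addition is coordinatewise XOR, 0 is the zero vector.
-- (APN-ness, almost-3-to-1-ness and f(0)=0 only involve the additive structure.)
F2^ : ℕ → Set
F2^ n = Vec Bool n

_⊕_ : ∀ {n} → F2^ n → F2^ n → F2^ n
_⊕_ = zipWith _xor_

𝟎 : ∀ {n} → F2^ n
𝟎 {n} = replicate n false

_≟_ : ∀ {n} → (x y : F2^ n) → Relation.Nullary.Dec (x ≡ y)
_≟_ = ≡-dec _≟B_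

elements : (n : ℕ) → List (F2^ n)
elements zero = [] ∷ []
elements (suc n) = map (false ∷_) (elements n) ++ map (true ∷_) (elements n)

#preimages : ∀ {n} → (F2^ n → F2^ n) → F2^ n → ℕ
#preimages {n} f y = length (filter (λ x → f x ≟ y) (elements n))

#solutions : ∀ {n} → (F2^ n → F2^ n) → F2^ n → F2^ n → ℕ
#solutions {n} f a b = length (filter (λ x → (f (x ⊕ a) ⊕ f x) ≟ b) (elements n))

InImage : ∀ {n} → (F2^ n → F2^ n) → F2^ n → Set
InImage f y = ∃ λ x → f x ≡ y

APN : ∀ {n} → (F2^ n → F2^ n) → Set
APN f = ∀ a → ¬ (a ≡ 𝟎) → ∀ b → #solutions f a b ≤ 2

Almost3to1 : ∀ {n} → (F2^ n → F2^ n) → Set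
Almost3to1 f = Σ _ λ y₀ → InImage f y₀ × #preimages f y₀ ≡ 1
  × (∀ y → InImage f y → ¬ (y ≡ y₀) → #preimages f y ≡ 3)

module Submission where

-- Write m y for the number of preimages of y. Counting pairs (x, x') with
-- f x = f x' in two ways gives ∑_y m(y)² = ∑_a #{x ∣ f(x+a) = f x}, which by
-- APN-ness is at most 2^n + 2(2^n − 1). As ∑_y m(y) = 2^n this says
-- ∑_y (m(y)² − 3 m(y) + 2[y = 0]) ≤ 0. Every summand is non-negative, since
-- m(0) ≥ 1 and m(y) ∈ {0} ∪ [3, ∞) for y ≠ 0, so all vanish: m(0) ∈ {1, 2}
-- and m(y) ∈ {0, 3} otherwise. Then 2^n ≡ m(0) (mod 3), and 2^n ≡ 1 for
-- even n forces m(0) = 1.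

open import Defs
open import Data.Nat using (ℕ; zero; suc; _+_; _*_; _^_; _≤_; _<_; z≤n; s≤s; NonZero)
open import Data.Nat.Properties
  using ( +-identityʳ; +-comm; *-comm; *-identityʳ; *-distribˡ-+; *-distribʳ-+; *-assoc
        ; *-cancelʳ-≡; *-zeroʳ; ≤-refl; ≤-reflexive; ≤-trans; ≤-antisym; m≤m+n; m≤n+m
        ; +-mono-≤; +-monoˡ-≤; +-monoʳ-≤; *-monoˡ-≤; +-cancelˡ-≤; +-cancelʳ-≤; m+1+n≰m
        ; module ≤-Reasoning )
open import Data.Nat.Divisibility using (_∣_; divides; quotient; ∣-refl; ∣m∣n⇒∣m+n; _∣0)
open import Data.Nat.DivMod using (_%_; [m+kn]%n≡m%n; %-distribˡ-*)
open import Data.Bool using (true; false; if_then_else_)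
open import Data.Vec using ([]; _∷_)
open import Data.Vec.Properties using (∷-injectiveʳ)
open import Data.List using (List; map; filter; length; _++_)
open import Data.Nat.ListAction using (sum)
open import Data.Nat.ListAction.Properties using (sum-++)
import Data.List as List
open import Data.List.Properties using (map-++; map-∘)
open import Data.Product using (∃; _×_; _,_; proj₁; proj₂)
open import Data.Sum using (_⊎_; inj₁; inj₂)
open import Data.Empty using (⊥-elim)
open import Function using (_∘_)
open import Relation.Nullary using (¬_; Dec; yes; no; does; ¬?; contradiction)
open import Relation.Unary using (Decidable)
open import Relation.Binary.PropositionalEquality
  using (_≡_; _≢_; _≗_; refl; sym; trans; cong; cong₂; subst; module ≡-Reasoning)
open import Data.Nat.Tactic.RingSolver using (solve-∀)

𝟙 : ∀ {p} {P : Set p} → Dec P → ℕ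
𝟙 d = if does d then 1 else 0

module _ {p} {P : Set p} where

  𝟙-yes : (d : Dec P) → P → 𝟙 d ≡ 1
  𝟙-yes (yes _) _ = refl
  𝟙-yes (no ¬p) p = ⊥-elim (¬p p)

  𝟙-no : (d : Dec P) → ¬ P → 𝟙 d ≡ 0
  𝟙-no (yes p) ¬p = ⊥-elim (¬p p)
  𝟙-no (no _) _ = refl

  𝟙≤1 : (d : Dec P) → 𝟙 d ≤ 1
  𝟙≤1 (yes _) = s≤s z≤n
  𝟙≤1 (no _) = z≤n

  𝟙-pos⇒ : (d : Dec P) → 0 < 𝟙 d → P
  𝟙-pos⇒ (yes p) _ = p

  𝟙-partition : (d : Dec P) (k : ℕ) → 𝟙 d * k + 𝟙 (¬? d) * k ≡ k
  𝟙-partition (yes _) k = trans (+-identityʳ (k + 0)) (+-identityʳ k)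
  𝟙-partition (no _) k = +-identityʳ k

𝟙-cong : ∀ {p q} {P : Set p} {Q : Set q} → (P → Q) → (Q → P) →
         (d : Dec P) (e : Dec Q) → 𝟙 d ≡ 𝟙 e
𝟙-cong P⇒Q Q⇒P (yes p) e = sym (𝟙-yes e (P⇒Q p))
𝟙-cong P⇒Q Q⇒P (no ¬p) e = sym (𝟙-no e (¬p ∘ Q⇒P))

length-filter≡sum-𝟙 : ∀ {a p} {A : Set a} {P : A → Set p} (P? : Decidable P) (xs : List A) →
                      length (filter P? xs) ≡ sum (map (𝟙 ∘ P?) xs)
length-filter≡sum-𝟙 P? List.[] = refl
length-filter≡sum-𝟙 P? (x List.∷ xs) with does (P? x)
... | false = length-filter≡sum-𝟙 P? xs
... | true = cong suc (length-filter≡sum-𝟙 P? xs)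

∑ : (n : ℕ) → (F2^ n → ℕ) → ℕ
∑ zero h = h []
∑ (suc n) h = ∑ n (h ∘ (false ∷_)) + ∑ n (h ∘ (true ∷_))

sum-elements≡∑ : ∀ n (h : F2^ n → ℕ) → sum (map h (elements n)) ≡ ∑ n h
sum-elements≡∑ zero h = +-identityʳ (h [])
sum-elements≡∑ (suc n) h = begin
  sum (map h (map (false ∷_) E ++ map (true ∷_) E))
    ≡⟨ cong sum (map-++ h (map (false ∷_) E) _) ⟩
  sum (map h (map (false ∷_) E) ++ map h (map (true ∷_) E))
    ≡⟨ sum-++ (map h (map (false ∷_) E)) _ ⟩
  sum (map h (map (false ∷_) E)) + sum (map h (map (true ∷_) E))
    ≡⟨ cong₂ _+_ (cong sum (sym (map-∘ E))) (cong sum (sym (map-∘ E))) ⟩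
  sum (map (h ∘ (false ∷_)) E) + sum (map (h ∘ (true ∷_)) E)
    ≡⟨ cong₂ _+_ (sum-elements≡∑ n _) (sum-elements≡∑ n _) ⟩
  ∑ (suc n) h ∎
  where
  open ≡-Reasoning
  E : List (F2^ n)
  E = elements n

count≡∑𝟙 : ∀ n {p} {P : F2^ n → Set p} (P? : Decidable P) →
           length (filter P? (elements n)) ≡ ∑ n (𝟙 ∘ P?)
count≡∑𝟙 n P? = trans (length-filter≡sum-𝟙 P? (elements n)) (sum-elements≡∑ n _)

∑-cong : ∀ n {h g : F2^ n → ℕ} → h ≗ g → ∑ n h ≡ ∑ n g
∑-cong zero h≗g = h≗g []
∑-cong (suc n) h≗g = cong₂ _+_ (∑-cong n (h≗g ∘ (false ∷_))) (∑-cong n (h≗g ∘ (true ∷_)))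

∑-mono-≤ : ∀ n {h g : F2^ n → ℕ} → (∀ x → h x ≤ g x) → ∑ n h ≤ ∑ n g
∑-mono-≤ zero h≤g = h≤g []
∑-mono-≤ (suc n) h≤g = +-mono-≤ (∑-mono-≤ n (h≤g ∘ (false ∷_))) (∑-mono-≤ n (h≤g ∘ (true ∷_)))

∑-+ : ∀ n (h g : F2^ n → ℕ) → ∑ n (λ x → h x + g x) ≡ ∑ n h + ∑ n g
∑-+ zero h g = refl
∑-+ (suc n) h g = trans
  (cong₂ _+_ (∑-+ n (h ∘ (false ∷_)) (g ∘ (false ∷_))) (∑-+ n (h ∘ (true ∷_)) (g ∘ (true ∷_))))
  (interchange (∑ n (h ∘ (false ∷_))) (∑ n (g ∘ (false ∷_))) (∑ n (h ∘ (true ∷_))) (∑ n (g ∘ (true ∷_))))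
  where interchange : ∀ a b c d → (a + b) + (c + d) ≡ (a + c) + (b + d)
        interchange = solve-∀

∑-*ˡ : ∀ n k (h : F2^ n → ℕ) → ∑ n (λ x → k * h x) ≡ k * ∑ n h
∑-*ˡ zero k h = refl
∑-*ˡ (suc n) k h = trans (cong₂ _+_ (∑-*ˡ n k (h ∘ (false ∷_))) (∑-*ˡ n k (h ∘ (true ∷_))))
                         (sym (*-distribˡ-+ k _ _))

∑-*ʳ : ∀ n k (h : F2^ n → ℕ) → ∑ n (λ x → h x * k) ≡ ∑ n h * k
∑-*ʳ zero k h = refl
∑-*ʳ (suc n) k h = trans (cong₂ _+_ (∑-*ʳ n k (h ∘ (false ∷_))) (∑-*ʳ n k (h ∘ (true ∷_))))
                         (sym (*-distribʳ-+ k (∑ n (h ∘ (false ∷_))) (∑ n (h ∘ (true ∷_)))))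

∑-const : ∀ n k → ∑ n (λ _ → k) ≡ 2 ^ n * k
∑-const zero k = sym (+-identityʳ k)
∑-const (suc n) k = trans (cong₂ _+_ (∑-const n k) (∑-const n k)) (doubling (2 ^ n) k)
  where doubling : ∀ a k → a * k + a * k ≡ (a + (a + 0)) * k
        doubling = solve-∀

∑-swap : ∀ n m (h : F2^ n → F2^ m → ℕ) → ∑ n (λ a → ∑ m (h a)) ≡ ∑ m (λ x → ∑ n (λ a → h a x))
∑-swap zero m h = refl
∑-swap (suc n) m h =
  trans (cong₂ _+_ (∑-swap n m (h ∘ (false ∷_))) (∑-swap n m (h ∘ (true ∷_))))
        (sym (∑-+ m (λ x → ∑ n (λ a → h (false ∷ a) x)) (λ x → ∑ n (λ a → h (true ∷ a) x))))

-- With literal heads, 𝟙 (b ∷ c ≟ b′ ∷ y) computes to 𝟙 (c ≟ y) or to 0.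
∑-δ : ∀ n (c : F2^ n) (g : F2^ n → ℕ) → ∑ n (λ y → 𝟙 (c ≟ y) * g y) ≡ g c
∑-δ zero [] g = +-identityʳ (g [])
∑-δ (suc n) (false ∷ c) g =
  trans (cong₂ _+_ (∑-δ n c (g ∘ (false ∷_))) (∑-const n 0)) (trans (cong (g (false ∷ c) +_) (*-zeroʳ (2 ^ n))) (+-identityʳ _))
∑-δ (suc n) (true ∷ c) g =
  trans (cong₂ _+_ (∑-const n 0) (∑-δ n c (g ∘ (true ∷_)))) (cong (_+ g (true ∷ c)) (*-zeroʳ (2 ^ n)))

∑-translate : ∀ n (c : F2^ n) (h : F2^ n → ℕ) → ∑ n (λ x → h (c ⊕ x)) ≡ ∑ n h
∑-translate zero [] h = refl
∑-translate (suc n) (false ∷ c) h =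
  cong₂ _+_ (∑-translate n c (h ∘ (false ∷_))) (∑-translate n c (h ∘ (true ∷_)))
∑-translate (suc n) (true ∷ c) h =
  trans (cong₂ _+_ (∑-translate n c (h ∘ (true ∷_))) (∑-translate n c (h ∘ (false ∷_))))
        (+-comm (∑ n (h ∘ (true ∷_))) _)

term≤∑ : ∀ n (h : F2^ n → ℕ) x → h x ≤ ∑ n h
term≤∑ zero h [] = ≤-refl
term≤∑ (suc n) h (false ∷ x) = ≤-trans (term≤∑ n (h ∘ (false ∷_)) x) (m≤m+n _ _)
term≤∑ (suc n) h (true ∷ x) = ≤-trans (term≤∑ n (h ∘ (true ∷_)) x) (m≤n+m _ _)

∑-pos⇒∃ : ∀ n (h : F2^ n → ℕ) → 0 < ∑ n h → ∃ λ x → 0 < h x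
∑-pos⇒∃ zero h 0<h = [] , 0<h
∑-pos⇒∃ (suc n) h 0<∑ with ∑ n (h ∘ (false ∷_)) in eq
... | suc _ = let x , 0<hx = ∑-pos⇒∃ n (h ∘ (false ∷_)) (subst (0 <_) (sym eq) (s≤s z≤n)) in false ∷ x , 0<hx
... | zero = let x , 0<hx = ∑-pos⇒∃ n (h ∘ (true ∷_)) 0<∑ in true ∷ x , 0<hx

+-≤-split : ∀ {a b c d} → c ≤ a → d ≤ b → a + b ≤ c + d → a ≤ c × b ≤ d
+-≤-split {a} {b} {c} {d} c≤a d≤b a+b≤c+d =
  +-cancelʳ-≤ b a c (≤-trans a+b≤c+d (+-monoʳ-≤ c d≤b)) ,
  +-cancelˡ-≤ a b d (≤-trans a+b≤c+d (+-monoˡ-≤ d c≤a))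

∑-tight : ∀ n (h g : F2^ n → ℕ) → (∀ x → g x ≤ h x) → ∑ n h ≤ ∑ n g → h ≗ g
∑-tight zero h g g≤h ∑h≤∑g [] = ≤-antisym ∑h≤∑g (g≤h [])
∑-tight (suc n) h g g≤h ∑h≤∑g (b ∷ x) = ∑-tight n (h ∘ (b ∷_)) (g ∘ (b ∷_)) (g≤h ∘ (b ∷_)) (half b) x
  where
  halves : ∑ n (h ∘ (false ∷_)) ≤ ∑ n (g ∘ (false ∷_)) × ∑ n (h ∘ (true ∷_)) ≤ ∑ n (g ∘ (true ∷_))
  halves = +-≤-split (∑-mono-≤ n (g≤h ∘ (false ∷_))) (∑-mono-≤ n (g≤h ∘ (true ∷_))) ∑h≤∑g
  half : ∀ b → ∑ n (h ∘ (b ∷_)) ≤ ∑ n (g ∘ (b ∷_))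
  half false = proj₁ halves
  half true = proj₂ halves

∑-∣ : ∀ n {d} (h : F2^ n → ℕ) → (∀ x → d ∣ h x) → d ∣ ∑ n h
∑-∣ zero h d∣h = d∣h []
∑-∣ (suc n) h d∣h = ∣m∣n⇒∣m+n (∑-∣ n (h ∘ (false ∷_)) (d∣h ∘ (false ∷_))) (∑-∣ n (h ∘ (true ∷_)) (d∣h ∘ (true ∷_)))

∑-extract : ∀ n (c : F2^ n) (h : F2^ n → ℕ) → ∑ n h ≡ h c + ∑ n (λ y → 𝟙 (¬? (c ≟ y)) * h y)
∑-extract n c h = begin
  ∑ n h
    ≡⟨ ∑-cong n (λ y → sym (𝟙-partition (c ≟ y) (h y))) ⟩
  ∑ n (λ y → 𝟙 (c ≟ y) * h y + 𝟙 (¬? (c ≟ y)) * h y)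
    ≡⟨ ∑-+ n _ _ ⟩
  ∑ n (λ y → 𝟙 (c ≟ y) * h y) + ∑ n (λ y → 𝟙 (¬? (c ≟ y)) * h y)
    ≡⟨ cong (_+ ∑ n (λ y → 𝟙 (¬? (c ≟ y)) * h y)) (∑-δ n c h) ⟩
  h c + ∑ n (λ y → 𝟙 (¬? (c ≟ y)) * h y) ∎
  where open ≡-Reasoning

∑-%-concentrated : ∀ n d .{{_ : NonZero d}} (c : F2^ n) (h : F2^ n → ℕ) →
                   (∀ y → y ≢ c → d ∣ h y) → ∑ n h % d ≡ h c % d
∑-%-concentrated n d c h d∣h = begin
  ∑ n h % d                         ≡⟨ cong (_% d) (∑-extract n c h) ⟩
  (h c + rest) % d                  ≡⟨ cong (λ r → (h c + r) % d) (_∣_.equality d∣rest) ⟩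
  (h c + quotient d∣rest * d) % d   ≡⟨ [m+kn]%n≡m%n (h c) (quotient d∣rest) d ⟩
  h c % d                           ∎
  where
  open ≡-Reasoning
  rest : ℕ
  rest = ∑ n (λ y → 𝟙 (¬? (c ≟ y)) * h y)
  d∣rest : d ∣ rest
  d∣rest = ∑-∣ n _ λ y → d∣term y (c ≟ y)
    where
    d∣term : ∀ y (c≟y : Dec (c ≡ y)) → d ∣ 𝟙 (¬? c≟y) * h y
    d∣term y (yes _) = d ∣0
    d∣term y (no c≢y) = subst (d ∣_) (sym (+-identityʳ (h y))) (d∣h y (c≢y ∘ sym))

⊕≡𝟎⇒≡ : ∀ {n} (u v : F2^ n) → u ⊕ v ≡ 𝟎 → u ≡ v
⊕≡𝟎⇒≡ [] [] _ = refl
⊕≡𝟎⇒≡ (false ∷ u) (false ∷ v) eq = cong (false ∷_) (⊕≡𝟎⇒≡ u v (∷-injectiveʳ eq))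
⊕≡𝟎⇒≡ (true ∷ u) (true ∷ v) eq = cong (true ∷_) (⊕≡𝟎⇒≡ u v (∷-injectiveʳ eq))

x⊕x≡𝟎 : ∀ {n} (x : F2^ n) → x ⊕ x ≡ 𝟎
x⊕x≡𝟎 [] = refl
x⊕x≡𝟎 (false ∷ x) = cong (false ∷_) (x⊕x≡𝟎 x)
x⊕x≡𝟎 (true ∷ x) = cong (false ∷_) (x⊕x≡𝟎 x)

module _ {n : ℕ} (f : F2^ n → F2^ n) where

  #preimages≡∑𝟙 : ∀ y → #preimages f y ≡ ∑ n (λ x → 𝟙 (f x ≟ y))
  #preimages≡∑𝟙 y = count≡∑𝟙 n (λ x → f x ≟ y)

  ∑-∘-fibres : (g : F2^ n → ℕ) → ∑ n (g ∘ f) ≡ ∑ n (λ y → #preimages f y * g y)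
  ∑-∘-fibres g = begin
    ∑ n (g ∘ f)                                    ≡⟨ ∑-cong n (λ x → sym (∑-δ n (f x) g)) ⟩
    ∑ n (λ x → ∑ n (λ y → 𝟙 (f x ≟ y) * g y))      ≡⟨ ∑-swap n n (λ x y → 𝟙 (f x ≟ y) * g y) ⟩
    ∑ n (λ y → ∑ n (λ x → 𝟙 (f x ≟ y) * g y))      ≡⟨ ∑-cong n (λ y → ∑-*ʳ n (g y) (λ x → 𝟙 (f x ≟ y))) ⟩
    ∑ n (λ y → ∑ n (λ x → 𝟙 (f x ≟ y)) * g y)      ≡⟨ ∑-cong n (λ y → cong (_* g y) (sym (#preimages≡∑𝟙 y))) ⟩
    ∑ n (λ y → #preimages f y * g y)               ∎
    where open ≡-Reasoning

  ∑-#preimages : ∑ n (#preimages f) ≡ 2 ^ n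
  ∑-#preimages = begin
    ∑ n (#preimages f)                   ≡⟨ ∑-cong n (λ y → sym (*-identityʳ (#preimages f y))) ⟩
    ∑ n (λ y → #preimages f y * 1)       ≡⟨ sym (∑-∘-fibres (λ _ → 1)) ⟩
    ∑ n (λ _ → 1)                        ≡⟨ ∑-const n 1 ⟩
    2 ^ n * 1                            ≡⟨ *-identityʳ (2 ^ n) ⟩
    2 ^ n                                ∎
    where open ≡-Reasoning

  #solutions-𝟎≡∑𝟙 : ∀ a → #solutions f a 𝟎 ≡ ∑ n (λ x → 𝟙 (f (x ⊕ a) ≟ f x))
  #solutions-𝟎≡∑𝟙 a = trans (count≡∑𝟙 n (λ x → (f (x ⊕ a) ⊕ f x) ≟ 𝟎)) (∑-cong n λ x →
    𝟙-cong (⊕≡𝟎⇒≡ (f (x ⊕ a)) (f x)) (λ eq → subst (λ z → z ⊕ f x ≡ 𝟎) (sym eq) (x⊕x≡𝟎 (f x)))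
           ((f (x ⊕ a) ⊕ f x) ≟ 𝟎) (f (x ⊕ a) ≟ f x))

  #solutions-𝟎≤2^n : ∀ a → #solutions f a 𝟎 ≤ 2 ^ n
  #solutions-𝟎≤2^n a = begin
    #solutions f a 𝟎                     ≡⟨ #solutions-𝟎≡∑𝟙 a ⟩
    ∑ n (λ x → 𝟙 (f (x ⊕ a) ≟ f x))      ≤⟨ ∑-mono-≤ n (λ x → 𝟙≤1 (f (x ⊕ a) ≟ f x)) ⟩
    ∑ n (λ _ → 1)                        ≡⟨ ∑-const n 1 ⟩
    2 ^ n * 1                            ≡⟨ *-identityʳ (2 ^ n) ⟩
    2 ^ n                                ∎
    where open ≤-Reasoning

  -- Both sides count the pairs (x, x') with f x = f x'.
  ∑-#solutions-𝟎 : ∑ n (λ a → #solutions f a 𝟎) ≡ ∑ n (λ y → #preimages f y * #preimages f y)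
  ∑-#solutions-𝟎 = begin
    ∑ n (λ a → #solutions f a 𝟎)                      ≡⟨ ∑-cong n #solutions-𝟎≡∑𝟙 ⟩
    ∑ n (λ a → ∑ n (λ x → 𝟙 (f (x ⊕ a) ≟ f x)))       ≡⟨ ∑-swap n n (λ a x → 𝟙 (f (x ⊕ a) ≟ f x)) ⟩
    ∑ n (λ x → ∑ n (λ a → 𝟙 (f (x ⊕ a) ≟ f x)))       ≡⟨ ∑-cong n (λ x → ∑-translate n x (λ z → 𝟙 (f z ≟ f x))) ⟩
    ∑ n (λ x → ∑ n (λ z → 𝟙 (f z ≟ f x)))             ≡⟨ ∑-cong n (λ x → sym (#preimages≡∑𝟙 (f x))) ⟩
    ∑ n (#preimages f ∘ f)                            ≡⟨ ∑-∘-fibres (#preimages f) ⟩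
    ∑ n (λ y → #preimages f y * #preimages f y)       ∎
    where open ≡-Reasoning

  InImage⇒1≤#preimages : ∀ {y} → InImage f y → 1 ≤ #preimages f y
  InImage⇒1≤#preimages {y} (x , fx≡y) = begin
    1                              ≡⟨ sym (𝟙-yes (f x ≟ y) fx≡y) ⟩
    𝟙 (f x ≟ y)                    ≤⟨ term≤∑ n (λ x → 𝟙 (f x ≟ y)) x ⟩
    ∑ n (λ x → 𝟙 (f x ≟ y))        ≡⟨ sym (#preimages≡∑𝟙 y) ⟩
    #preimages f y                 ∎
    where open ≤-Reasoning

  1≤#preimages⇒InImage : ∀ {y} → 1 ≤ #preimages f y → InImage f y
  1≤#preimages⇒InImage {y} 1≤m =
    let x , 0<𝟙 = ∑-pos⇒∃ n (λ x → 𝟙 (f x ≟ y)) (≤-trans 1≤m (≤-reflexive (#preimages≡∑𝟙 y)))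
    in x , 𝟙-pos⇒ (f x ≟ y) 0<𝟙

  -- The summand 2 at a = 𝟎 turns the APN bound 2 for a ≢ 𝟎 into a bound valid for every a.
  APN⇒∑-squares≤ : APN f →
    ∑ n (λ y → #preimages f y * #preimages f y + 𝟙 (𝟎 ≟ y) * 2) ≤ ∑ n (λ y → 3 * #preimages f y)
  APN⇒∑-squares≤ apn = begin
    ∑ n (λ y → m y * m y + 𝟙 (𝟎 ≟ y) * 2)
      ≡⟨ ∑-+ n (λ y → m y * m y) (λ y → 𝟙 (𝟎 ≟ y) * 2) ⟩
    ∑ n (λ y → m y * m y) + ∑ n (λ y → 𝟙 (𝟎 ≟ y) * 2)
      ≡⟨ cong (_+ ∑ n (λ y → 𝟙 (𝟎 ≟ y) * 2)) (sym ∑-#solutions-𝟎) ⟩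
    ∑ n (λ a → #solutions f a 𝟎) + ∑ n (λ a → 𝟙 (𝟎 ≟ a) * 2)
      ≡⟨ sym (∑-+ n (λ a → #solutions f a 𝟎) (λ a → 𝟙 (𝟎 ≟ a) * 2)) ⟩
    ∑ n (λ a → #solutions f a 𝟎 + 𝟙 (𝟎 ≟ a) * 2)
      ≤⟨ ∑-mono-≤ n (λ a → bound a (𝟎 ≟ a)) ⟩
    ∑ n (λ a → 𝟙 (𝟎 ≟ a) * 2 ^ n + 2)
      ≡⟨ ∑-+ n (λ a → 𝟙 (𝟎 ≟ a) * 2 ^ n) (λ _ → 2) ⟩
    ∑ n (λ a → 𝟙 (𝟎 ≟ a) * 2 ^ n) + ∑ n (λ _ → 2)
      ≡⟨ cong₂ _+_ (∑-δ n 𝟎 (λ _ → 2 ^ n)) (∑-const n 2) ⟩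
    2 ^ n + 2 ^ n * 2
      ≡⟨ cong (2 ^ n +_) (*-comm (2 ^ n) 2) ⟩
    3 * 2 ^ n
      ≡⟨ cong (3 *_) (sym ∑-#preimages) ⟩
    3 * ∑ n m
      ≡⟨ sym (∑-*ˡ n 3 m) ⟩
    ∑ n (λ y → 3 * m y) ∎
    where
    open ≤-Reasoning
    m : F2^ n → ℕ
    m = #preimages f
    bound : ∀ a (𝟎≟a : Dec (𝟎 ≡ a)) → #solutions f a 𝟎 + 𝟙 𝟎≟a * 2 ≤ 𝟙 𝟎≟a * 2 ^ n + 2
    bound a (yes _) = +-monoˡ-≤ 2 (≤-trans (#solutions-𝟎≤2^n a) (≤-reflexive (sym (+-identityʳ (2 ^ n)))))
    bound a (no 𝟎≢a) = ≤-trans (≤-reflexive (+-identityʳ _)) (apn a (𝟎≢a ∘ sym) 𝟎)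

3k≤k*k : ∀ k → k ≡ 0 ⊎ 3 ≤ k → 3 * k ≤ k * k
3k≤k*k .0 (inj₁ refl) = z≤n
3k≤k*k k (inj₂ 3≤k) = *-monoˡ-≤ k 3≤k

k*k≡3k⇒k≡0∨k≡3 : ∀ k → k * k ≡ 3 * k → k ≡ 0 ⊎ k ≡ 3
k*k≡3k⇒k≡0∨k≡3 zero _ = inj₁ refl
k*k≡3k⇒k≡0∨k≡3 k@(suc _) eq = inj₂ (*-cancelʳ-≡ k 3 k eq)

3k≤k*k+2 : ∀ k → 1 ≤ k → 3 * k ≤ k * k + 2
3k≤k*k+2 1 _ = ≤-refl
3k≤k*k+2 2 _ = ≤-refl
3k≤k*k+2 k@(suc (suc (suc _))) _ = ≤-trans (3k≤k*k k (inj₂ (s≤s (s≤s (s≤s z≤n))))) (m≤m+n (k * k) 2)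

k*k+2≡3k⇒k≡1∨k≡2 : ∀ k → k * k + 2 ≡ 3 * k → k ≡ 1 ⊎ k ≡ 2
k*k+2≡3k⇒k≡1∨k≡2 1 _ = inj₁ refl
k*k+2≡3k⇒k≡1∨k≡2 2 _ = inj₂ refl
k*k+2≡3k⇒k≡1∨k≡2 k@(suc (suc (suc _))) eq =
  ⊥-elim (m+1+n≰m (3 * k) (≤-trans (+-monoˡ-≤ 2 (3k≤k*k k (inj₂ (s≤s (s≤s (s≤s z≤n)))))) (≤-reflexive eq)))

2^[k*2]%3≡1 : ∀ k → 2 ^ (k * 2) % 3 ≡ 1
2^[k*2]%3≡1 zero = refl
2^[k*2]%3≡1 (suc k) = begin
  2 * (2 * 2 ^ (k * 2)) % 3          ≡⟨ cong (_% 3) (sym (*-assoc 2 2 (2 ^ (k * 2)))) ⟩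
  4 * 2 ^ (k * 2) % 3                ≡⟨ %-distribˡ-* 4 (2 ^ (k * 2)) 3 ⟩
  (4 % 3) * (2 ^ (k * 2) % 3) % 3    ≡⟨ cong (λ r → (4 % 3) * r % 3) (2^[k*2]%3≡1 k) ⟩
  1                                  ∎
  where open ≡-Reasoning

even⇒2^n%3≡1 : ∀ {n} → 2 ∣ n → 2 ^ n % 3 ≡ 1
even⇒2^n%3≡1 (divides k refl) = 2^[k*2]%3≡1 k

module FibreSizes {n : ℕ} (f : F2^ n → F2^ n) (apn : APN f) (f𝟎≡𝟎 : f 𝟎 ≡ 𝟎)
         (≥3-preimages : ∀ y → InImage f y → ¬ (y ≡ 𝟎) → 3 ≤ #preimages f y) where

  3#preimages≤#preimages²+2[y≡𝟎] : ∀ y → 3 * #preimages f y ≤ #preimages f y * #preimages f y + 𝟙 (𝟎 ≟ y) * 2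
  3#preimages≤#preimages²+2[y≡𝟎] y with 𝟎 ≟ y
  ... | yes refl = 3k≤k*k+2 (#preimages f 𝟎) (InImage⇒1≤#preimages f (𝟎 , f𝟎≡𝟎))
  ... | no 𝟎≢y = ≤-trans (3k≤k*k (#preimages f y) (#preimages≡0∨≥3 (𝟎≢y ∘ sym))) (m≤m+n _ 0)
    where
    #preimages≡0∨≥3 : y ≢ 𝟎 → #preimages f y ≡ 0 ⊎ 3 ≤ #preimages f y
    #preimages≡0∨≥3 y≢𝟎 with #preimages f y in eq
    ... | zero = inj₁ refl
    ... | suc _ = inj₂ (subst (3 ≤_) eq (≥3-preimages y (1≤#preimages⇒InImage f 1≤m) y≢𝟎))
      where 1≤m : 1 ≤ #preimages f y
            1≤m = subst (1 ≤_) (sym eq) (s≤s z≤n)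

  #preimages²+2[y≡𝟎]≡3#preimages : ∀ y → #preimages f y * #preimages f y + 𝟙 (𝟎 ≟ y) * 2 ≡ 3 * #preimages f y
  #preimages²+2[y≡𝟎]≡3#preimages =
    ∑-tight n _ (λ y → 3 * #preimages f y) 3#preimages≤#preimages²+2[y≡𝟎] (APN⇒∑-squares≤ f apn)

  #preimages-𝟎≡1∨2 : #preimages f 𝟎 ≡ 1 ⊎ #preimages f 𝟎 ≡ 2
  #preimages-𝟎≡1∨2 = k*k+2≡3k⇒k≡1∨k≡2 m𝟎 (begin
    m𝟎 * m𝟎 + 2                      ≡⟨ cong (λ t → m𝟎 * m𝟎 + t * 2) (sym (𝟙-yes (𝟎 {n} ≟ 𝟎) refl)) ⟩
    m𝟎 * m𝟎 + 𝟙 (𝟎 {n} ≟ 𝟎) * 2          ≡⟨ #preimages²+2[y≡𝟎]≡3#preimages 𝟎 ⟩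
    3 * m𝟎                           ∎)
    where
    open ≡-Reasoning
    m𝟎 : ℕ
    m𝟎 = #preimages f 𝟎

  #preimages-≢𝟎≡0∨3 : ∀ y → y ≢ 𝟎 → #preimages f y ≡ 0 ⊎ #preimages f y ≡ 3
  #preimages-≢𝟎≡0∨3 y y≢𝟎 = k*k≡3k⇒k≡0∨k≡3 m (begin
    m * m                            ≡⟨ sym (+-identityʳ (m * m)) ⟩
    m * m + 0                        ≡⟨ cong (λ t → m * m + t * 2) (sym (𝟙-no (𝟎 ≟ y) (y≢𝟎 ∘ sym))) ⟩
    m * m + 𝟙 (𝟎 ≟ y) * 2            ≡⟨ #preimages²+2[y≡𝟎]≡3#preimages y ⟩
    3 * m                            ∎)
    where
    open ≡-Reasoning
    m : ℕ
    m = #preimages f y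

  3∣#preimages-≢𝟎 : ∀ y → y ≢ 𝟎 → 3 ∣ #preimages f y
  3∣#preimages-≢𝟎 y y≢𝟎 with #preimages-≢𝟎≡0∨3 y y≢𝟎
  ... | inj₁ m≡0 = subst (3 ∣_) (sym m≡0) (3 ∣0)
  ... | inj₂ m≡3 = subst (3 ∣_) (sym m≡3) ∣-refl

proposition4p7 : (n : ℕ) → 2 ∣ n → (f : F2^ n → F2^ n) → APN f → f 𝟎 ≡ 𝟎
    → (∀ y → InImage f y → ¬ (y ≡ 𝟎) → 3 ≤ #preimages f y)
    → Almost3to1 f
proposition4p7 n 2∣n f apn f𝟎≡𝟎 ≥3-preimages = 𝟎 , (𝟎 , f𝟎≡𝟎) , #preimages-𝟎≡1 , #preimages-≢𝟎≡3
  where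
  open ≡-Reasoning
  open FibreSizes f apn f𝟎≡𝟎 ≥3-preimages

  #preimages-𝟎%3≡1 : #preimages f 𝟎 % 3 ≡ 1
  #preimages-𝟎%3≡1 = begin
    #preimages f 𝟎 % 3       ≡⟨ sym (∑-%-concentrated n 3 𝟎 (#preimages f) (3∣#preimages-≢𝟎)) ⟩
    ∑ n (#preimages f) % 3   ≡⟨ cong (_% 3) (∑-#preimages f) ⟩
    2 ^ n % 3                ≡⟨ even⇒2^n%3≡1 2∣n ⟩
    1                        ∎

  #preimages-𝟎≡1 : #preimages f 𝟎 ≡ 1
  #preimages-𝟎≡1 with #preimages-𝟎≡1∨2
  ... | inj₁ m≡1 = m≡1
  ... | inj₂ m≡2 = contradiction (subst (λ k → k % 3 ≡ 1) m≡2 #preimages-𝟎%3≡1) λ ()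

  #preimages-≢𝟎≡3 : ∀ y → InImage f y → y ≢ 𝟎 → #preimages f y ≡ 3
  #preimages-≢𝟎≡3 y image y≢𝟎 with #preimages-≢𝟎≡0∨3 y y≢𝟎
  ... | inj₂ m≡3 = m≡3
  ... | inj₁ m≡0 = contradiction (subst (1 ≤_) m≡0 (InImage⇒1≤#preimages f image)) λ ()
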